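{- Let $\hat A$ be a transitive change action whose base set $A$ has a distinguished element $\bot$, fix a difference operator $\ominus$ for $\hat A$, and let $f:A\to A$ be a function with derivative $\partial f$. Let $\mathrm{iter}(f,n)=f^n(\bot)$ and define $\partial_2\mathrm{iter}(f,n,m)$ for $n,m\in\mathbb N$ by $\partial_2\mathrm{iter}(f,0,m)=\mathrm{iter}(f,m)\ominus\mathrm{iter}(f,0)$ and $\partial_2\mathrm{iter}(f,n,m)=\partial f(\mathrm{iter}(f,n-1),\partial_2\mathrm{iter}(f,n-1,m))$ for $n\ge1$. Then $\mathrm{iter}$ is differentiable in its second argument with respect to the change action $(\mathbb N,\mathbb N,+,+,0)$, with partial derivative $\partial_2\mathrm{iter}$; that is, $\mathrm{iter}(f,n+m)=\mathrm{iter}(f,n)\oplus\partial_2\mathrm{iter}(f,n,m)$ for all $n,m\in\mathbb N$.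
   Context: A change action $\hat A=(A,\Delta A,\oplus,+,0)$ is a set $A$, a monoid $(\Delta A,+,0)$ and a monoid action $\oplus:A\times\Delta A\to A$ ($a\oplus 0=a$, $a\oplus(\delta_1+\delta_2)=(a\oplus\delta_1)\oplus\delta_2$). It is transitive if for all $a,b$ there is $\delta$ with $a\oplus\delta=b$. A difference operator is $\ominus:A\times A\to\Delta A$ with $a\oplus(b\ominus a)=b$. A derivative of $f:A\to A$ is $\partial f:A\times\Delta A\to\Delta A$ with $f(a\oplus\delta)=f(a)\oplus\partial f(a,\delta)$. In the paper $\bot$ is the least element of a pointed dcpo. -}

module Defs where

open import Level using (Level; _⊔_; suc)
open import Data.Nat using (ℕ; zero; suc)
open import Data.Product using (∃)
open import Relation.Binary.PropositionalEquality using (_≡_)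
open import Algebra.Structures using (IsMonoid)

record ChangeAction (a d : Level) : Set (Level.suc (a ⊔ d)) where
  infixl 6 _⊕_ _+Δ_
  field
    A        : Set a
    ΔA       : Set d
    _⊕_      : A → ΔA → A
    _+Δ_     : ΔA → ΔA → ΔA
    0Δ       : ΔA
    isMonoid : IsMonoid _≡_ _+Δ_ 0Δ
    ⊕-identity : ∀ x → x ⊕ 0Δ ≡ x
    ⊕-act      : ∀ x δ₁ δ₂ → x ⊕ (δ₁ +Δ δ₂) ≡ (x ⊕ δ₁) ⊕ δ₂

module _ {a d : Level} (Â : ChangeAction a d) where
  open ChangeAction Â

  Transitive : Set (a ⊔ d)
  Transitive = ∀ x y → ∃ λ δ → x ⊕ δ ≡ y

  IsDifferenceOperator : (A → A → ΔA) → Set a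
  IsDifferenceOperator _⊖_ = ∀ x y → x ⊕ (y ⊖ x) ≡ y

  IsDerivative : (A → A) → (A → ΔA → ΔA) → Set (a ⊔ d)
  IsDerivative f ∂f = ∀ x δ → f (x ⊕ δ) ≡ f x ⊕ ∂f x δ

  iter : A → (A → A) → ℕ → A
  iter ⊥ f zero    = ⊥
  iter ⊥ f (suc n) = f (iter ⊥ f n)

  ∂₂iter : A → (A → A → ΔA) → (A → A) → (A → ΔA → ΔA) → ℕ → ℕ → ΔA
  ∂₂iter ⊥ _⊖_ f ∂f zero    m = iter ⊥ f m ⊖ iter ⊥ f zero
  ∂₂iter ⊥ _⊖_ f ∂f (suc n) m = ∂f (iter ⊥ f n) (∂₂iter ⊥ _⊖_ f ∂f n m)

module Submission where

open import Defs
open import Level using (Level)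
open import Data.Nat using (ℕ; _+_; zero; suc)
open import Relation.Binary.PropositionalEquality using (_≡_; cong; sym; module ≡-Reasoning)

module _ {a d : Level} (Â : ChangeAction a d) where
  open ChangeAction Â

  iter-+-≡-⊕-∂₂iter : (⊥ : A) (_⊖_ : A → A → ΔA) → IsDifferenceOperator Â _⊖_ →
                      (f : A → A) (∂f : A → ΔA → ΔA) → IsDerivative Â f ∂f →
                      ∀ n m → iter Â ⊥ f (n + m) ≡ iter Â ⊥ f n ⊕ ∂₂iter Â ⊥ _⊖_ f ∂f n m
  iter-+-≡-⊕-∂₂iter ⊥ _⊖_ ⊖-correct f ∂f ∂f-correct zero    m = sym (⊖-correct ⊥ (iter Â ⊥ f m))
  iter-+-≡-⊕-∂₂iter ⊥ _⊖_ ⊖-correct f ∂f ∂f-correct (suc n) m = begin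
    f (iter Â ⊥ f (n + m))                      ≡⟨ cong f (iter-+-≡-⊕-∂₂iter ⊥ _⊖_ ⊖-correct f ∂f ∂f-correct n m) ⟩
    f (iter Â ⊥ f n ⊕ ∂₂iter Â ⊥ _⊖_ f ∂f n m)  ≡⟨ ∂f-correct (iter Â ⊥ f n) (∂₂iter Â ⊥ _⊖_ f ∂f n m) ⟩
    f (iter Â ⊥ f n) ⊕ ∂₂iter Â ⊥ _⊖_ f ∂f (suc n) m  ∎
    where open ≡-Reasoning

mainTheorem17 : ∀ {a d : Level} (Â : ChangeAction a d) →
    let open ChangeAction Â in
    Transitive Â →
    (⊥ : A) →
    (_⊖_ : A → A → ΔA) → IsDifferenceOperator Â _⊖_ →
    (f : A → A) (∂f : A → ΔA → ΔA) → IsDerivative Â f ∂f →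
    ∀ (n m : ℕ) → iter Â ⊥ f (n + m) ≡ iter Â ⊥ f n ⊕ ∂₂iter Â ⊥ _⊖_ f ∂f n m
mainTheorem17 Â _ = iter-+-≡-⊕-∂₂iter Â
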